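{- Let $G$ be a finite, simple, connected graph. Then $\mathrm{gp}^-(G) = 2$ if and only if $G$ has a universal line.
   Context: For vertices $u,v$ of $G$, $d_G(u,v)$ is the length of a shortest $u,v$-path. A set $S\subseteq V(G)$ is a general position set if no shortest path (geodesic) of $G$ contains three or more vertices of $S$. A general position set is maximal if it is not a proper subset of another general position set. The lower general position number $\mathrm{gp}^-(G)$ is the number of vertices in a smallest maximal general position set of $G$. For $x,y\in V(G)$, the line $\mathcal{L}_G(x,y)$ is the set of vertices $z$ with $d_G(x,y)=d_G(x,z)+d_G(z,y)$ or $d_G(x,y)=|d_G(x,z)-d_G(z,y)|$. The line is universal if $\mathcal{L}_G(x,y)=V(G)$. -}

module Defs where

open import Data.Nat using (ℕ; zero; suc; _+_; _≤_; ∣_-_∣)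
open import Data.Fin using (Fin)
open import Data.Fin.Subset using (Subset; _∈_; _⊆_; ∣_∣)
open import Data.Bool using (Bool; T)
open import Data.Product using (Σ; ∃; _×_; _,_)
import Data.Product
open import Data.Sum using (_⊎_)
open import Relation.Binary.PropositionalEquality using (_≡_; _≢_)
open import Relation.Nullary using (¬_)
open import Data.Empty using (⊥)

record Graph (n : ℕ) : Set where
  field
    adj     : Fin n → Fin n → Bool
    adj-sym : ∀ u v → adj u v ≡ adj v u
    adj-irr : ∀ u → adj u u ≡ Data.Bool.false

open Graph public

module _ {n : ℕ} (G : Graph n) where

  Adj : Fin n → Fin n → Set
  Adj u v = T (adj G u v)

  data Walk : Fin n → Fin n → ℕ → Set where
    here : ∀ {u} → Walk u u 0
    step : ∀ {u w v k} → Adj u w → Walk w v k → Walk u v (suc k)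

  data OnWalk (z : Fin n) : ∀ {u v k} → Walk u v k → Set where
    on-here  : ∀ {v k} (p : Walk z v k) → OnWalk z p
    on-there : ∀ {u w v k} (e : Adj u w) (p : Walk w v k) →
               OnWalk z p → OnWalk z (step e p)

  Connected : Set
  Connected = ∀ u v → ∃ λ k → Walk u v k

  Dist : Fin n → Fin n → ℕ → Set
  Dist u v d = Walk u v d × (∀ m → Walk u v m → d ≤ m)

  Geodesic : Fin n → Fin n → ℕ → Set
  Geodesic u v k = Σ (Walk u v k) λ _ → Dist u v k

  GeneralPosition : Subset n → Set
  GeneralPosition S =
    ∀ {u v k} → (g : Geodesic u v k) → let p = Data.Product.proj₁ g in
    ∀ x y z → x ∈ S → y ∈ S → z ∈ S →
    x ≢ y → y ≢ z → x ≢ z →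
    OnWalk x p → OnWalk y p → OnWalk z p → ⊥

  MaximalGP : Subset n → Set
  MaximalGP S = GeneralPosition S × (∀ T → GeneralPosition T → S ⊆ T → T ⊆ S)

  LowerGPNumber : ℕ → Set
  LowerGPNumber k =
    (∃ λ S → MaximalGP S × ∣ S ∣ ≡ k) × (∀ S → MaximalGP S → k ≤ ∣ S ∣)

  InLine : Fin n → Fin n → Fin n → Set
  InLine x y z = ∀ a b c → Dist x y a → Dist x z b → Dist z y c →
                 (a ≡ b + c) ⊎ (a ≡ ∣ b - c ∣)

  UniversalLine : Fin n → Fin n → Set
  UniversalLine x y = x ≢ y × (∀ z → InLine x y z)

  HasUniversalLine : Set
  HasUniversalLine = ∃ λ x → ∃ λ y → UniversalLine x y

-- Three vertices lie on a common geodesic exactly when one of their distances is the sum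
-- or the difference of the other two, i.e. when the third lies on the line of the first two:
-- along a geodesic, distances are differences of positions.  If {x, y} is a maximal general
-- position set, adding any further vertex z must create a geodesic through x, y and z, so
-- L(x, y) is universal.  Conversely, if L(x, y) is universal then every vertex outside {x, y}
-- lies on a geodesic with x and y, so {x, y} is maximal; and no maximal general position set
-- has fewer than two vertices, since every set of at most two vertices is in general position.
module Submission where

open import Defs
open import Function.Bundles using (_⇔_; mk⇔)
open import Data.Nat using (ℕ; zero; suc; _+_; _∸_; _≤_; _<_; z≤n; s≤s; ∣_-_∣) renaming (_≟_ to _≟ℕ_)
open import Data.Nat.Properties
open import Data.Nat.Induction using (<-wellFounded)
open import Induction.WellFounded using (Acc; acc)
open import Data.Fin using (Fin) renaming (_≟_ to _≟ᶠ_)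
open import Data.Fin.Properties using (any?)
open import Data.Fin.Subset using (Subset; _∈_; _∉_; _⊆_; _∪_; ⁅_⁆; ⊥; ∣_∣)
open import Data.Fin.Subset.Properties
open import Data.Bool using (T; true; false)
open import Data.Vec using (_∷_; [])
open import Data.Product using (Σ; ∃; ∃₂; _×_; _,_; proj₂)
open import Data.Sum using (_⊎_; inj₁; inj₂)
open import Data.Empty using (⊥-elim)
open import Relation.Binary.PropositionalEquality using (module ≡-Reasoning; _≡_; _≢_; ≢-sym; refl; sym; trans; cong; subst)
open import Relation.Nullary using (¬_; Dec; yes; no)
open import Relation.Nullary.Decidable using (T?; _×-dec_; _⊎-dec_; ¬?; decidable-stable)

∣m-n∣-cases : ∀ m n → m ≡ ∣ m - n ∣ + n ⊎ n ≡ m + ∣ m - n ∣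
∣m-n∣-cases m n with ≤-total m n
... | inj₁ m≤n = inj₂ (sym (trans (cong (m +_) (m≤n⇒∣m-n∣≡n∸m m≤n)) (m+[n∸m]≡n m≤n)))
... | inj₂ n≤m = inj₁ (sym (trans (cong (_+ n) (m≤n⇒∣n-m∣≡n∸m n≤m)) (m∸n+n≡m n≤m)))

∣-∣-collinear : ∀ m n o → ∣ m - n ∣ ≡ ∣ m - o ∣ + ∣ o - n ∣ ⊎ ∣ m - n ∣ ≡ ∣ ∣ m - o ∣ - ∣ o - n ∣ ∣
∣-∣-collinear zero          n       o       = first-at-0 o n
  where
  first-at-0 : ∀ o n → n ≡ o + ∣ o - n ∣ ⊎ n ≡ ∣ o - ∣ o - n ∣ ∣
  first-at-0 o n with ∣m-n∣-cases o n
  ... | inj₂ n≡o+d = inj₁ n≡o+d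
  ... | inj₁ o≡d+n = inj₂ (sym (begin
    ∣ o - d ∣         ≡⟨ cong ∣_- d ∣ o≡d+n ⟩
    ∣ d + n - d ∣     ≡⟨ ∣-∣-comm (d + n) d ⟩
    ∣ d - d + n ∣     ≡⟨ ∣m-m+n∣≡n d n ⟩
    n                 ∎))
    where open ≡-Reasoning
          d = ∣ o - n ∣
∣-∣-collinear (suc m)       zero    zero    = inj₁ (sym (+-identityʳ (suc m)))
∣-∣-collinear (suc m)       zero    (suc o) = second-at-0 (suc m) (suc o)
  where
  second-at-0 : ∀ m o → m ≡ ∣ m - o ∣ + o ⊎ m ≡ ∣ ∣ m - o ∣ - o ∣
  second-at-0 m o with ∣m-n∣-cases m o
  ... | inj₁ m≡d+o = inj₁ m≡d+o
  ... | inj₂ o≡m+d = inj₂ (sym (begin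
    ∣ d - o ∣         ≡⟨ cong ∣ d -_∣ o≡m+d ⟩
    ∣ d - m + d ∣     ≡⟨ cong ∣ d -_∣ (+-comm m d) ⟩
    ∣ d - d + m ∣     ≡⟨ ∣m-m+n∣≡n d m ⟩
    m                 ∎))
    where open ≡-Reasoning
          d = ∣ m - o ∣
∣-∣-collinear (suc m)       (suc n) zero    = inj₂ refl
∣-∣-collinear (suc m)       (suc n) (suc o) = ∣-∣-collinear m n o

∣p∪q∣≤∣p∣+∣q∣ : ∀ {m} (p q : Subset m) → ∣ p ∪ q ∣ ≤ ∣ p ∣ + ∣ q ∣
∣p∪q∣≤∣p∣+∣q∣ []          []          = z≤n
∣p∪q∣≤∣p∣+∣q∣ (true ∷ p)  (true ∷ q)  = s≤s (≤-trans (∣p∪q∣≤∣p∣+∣q∣ p q) (+-monoʳ-≤ ∣ p ∣ (n≤1+n ∣ q ∣)))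
∣p∪q∣≤∣p∣+∣q∣ (true ∷ p)  (false ∷ q) = s≤s (∣p∪q∣≤∣p∣+∣q∣ p q)
∣p∪q∣≤∣p∣+∣q∣ (false ∷ p) (true ∷ q)  = ≤-trans (s≤s (∣p∪q∣≤∣p∣+∣q∣ p q)) (≤-reflexive (sym (+-suc ∣ p ∣ ∣ q ∣)))
∣p∪q∣≤∣p∣+∣q∣ (false ∷ p) (false ∷ q) = ∣p∪q∣≤∣p∣+∣q∣ p q

module _ {m : ℕ} where

  ∣p∪⁅x⁆∣≤1+∣p∣ : (p : Subset m) (x : Fin m) → ∣ p ∪ ⁅ x ⁆ ∣ ≤ suc ∣ p ∣
  ∣p∪⁅x⁆∣≤1+∣p∣ p x = ≤-trans (∣p∪q∣≤∣p∣+∣q∣ p ⁅ x ⁆)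
    (≤-reflexive (trans (cong (∣ p ∣ +_) (∣⁅x⁆∣≡1 x)) (+-comm ∣ p ∣ 1)))

  x∈p∪⁅x⁆ : (p : Subset m) (x : Fin m) → x ∈ p ∪ ⁅ x ⁆
  x∈p∪⁅x⁆ p x = x∈p∪q⁺ (inj₂ (x∈⁅x⁆ x))

  x∈p⇒0<∣p∣ : ∀ {x : Fin m} {p} → x ∈ p → 0 < ∣ p ∣
  x∈p⇒0<∣p∣ x∈p = ≤-<-trans z≤n (x∈p⇒∣p-x∣<∣p∣ x∈p)

  distinct-pair⇒2≤∣p∣ : ∀ {x y : Fin m} {p} → x ∈ p → y ∈ p → x ≢ y → 2 ≤ ∣ p ∣
  distinct-pair⇒2≤∣p∣ x∈p y∈p x≢y =
    ≤-<-trans (x∈p⇒0<∣p∣ (x∈p∧x≢y⇒x∈p-y y∈p (≢-sym x≢y))) (x∈p⇒∣p-x∣<∣p∣ x∈p)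

  ∣⁅x⁆∪⁅y⁆∣≡2 : ∀ {x y : Fin m} → x ≢ y → ∣ ⁅ x ⁆ ∪ ⁅ y ⁆ ∣ ≡ 2
  ∣⁅x⁆∪⁅y⁆∣≡2 {x} {y} x≢y = ≤-antisym
    (≤-trans (∣p∪⁅x⁆∣≤1+∣p∣ ⁅ x ⁆ y) (s≤s (≤-reflexive (∣⁅x⁆∣≡1 x))))
    (distinct-pair⇒2≤∣p∣ (p⊆p∪q ⁅ y ⁆ (x∈⁅x⁆ x)) (x∈p∪⁅x⁆ ⁅ x ⁆ y) x≢y)

  distinct-triple⇒3≤∣p∣ : ∀ {x y z : Fin m} {p} → x ∈ p → y ∈ p → z ∈ p →
                          x ≢ y → y ≢ z → x ≢ z → 3 ≤ ∣ p ∣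
  distinct-triple⇒3≤∣p∣ x∈p y∈p z∈p x≢y y≢z x≢z =
    ≤-<-trans (distinct-pair⇒2≤∣p∣ (x∈p∧x≢y⇒x∈p-y y∈p (≢-sym x≢y))
                                   (x∈p∧x≢y⇒x∈p-y z∈p (≢-sym x≢z)) y≢z)
              (x∈p⇒∣p-x∣<∣p∣ x∈p)

  ∣q∣<∣p∣⇒∃∈p∉q : ∀ {p q : Subset m} → ∣ q ∣ < ∣ p ∣ → ∃ λ x → x ∈ p × x ∉ q
  ∣q∣<∣p∣⇒∃∈p∉q {p} {q} ∣q∣<∣p∣ with any? (λ x → x ∈? p ×-dec ¬? (x ∈? q))
  ... | yes witness = witness
  ... | no none     = ⊥-elim (<⇒≱ ∣q∣<∣p∣ (p⊆q⇒∣p∣≤∣q∣ p⊆q))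
    where
    p⊆q : ∀ {x} → x ∈ p → x ∈ q
    p⊆q {x} x∈p = decidable-stable (x ∈? q) (λ x∉q → none (x , x∈p , x∉q))

  2≤∣p∣⇒distinct-pair : ∀ {p : Subset m} → 2 ≤ ∣ p ∣ → ∃₂ λ x y → x ∈ p × y ∈ p × x ≢ y
  2≤∣p∣⇒distinct-pair {p} 2≤∣p∣
    with ∣q∣<∣p∣⇒∃∈p∉q {q = ⊥ {n = m}} (subst (_< ∣ p ∣) (sym (∣⊥∣≡0 m)) (≤-trans (s≤s z≤n) 2≤∣p∣))
  ... | x , x∈p , _
    with ∣q∣<∣p∣⇒∃∈p∉q {q = ⁅ x ⁆} (subst (_< ∣ p ∣) (sym (∣⁅x⁆∣≡1 x)) 2≤∣p∣)
  ... | y , y∈p , y∉⁅x⁆ = x , y , x∈p , y∈p , λ { refl → y∉⁅x⁆ (x∈⁅x⁆ x) }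

  ∣p∣≤3⇒covered-by-triple : ∀ {x y z w : Fin m} {p} → ∣ p ∣ ≤ 3 → x ∈ p → y ∈ p → z ∈ p →
                            x ≢ y → y ≢ z → x ≢ z → w ∈ p → w ≡ x ⊎ w ≡ y ⊎ w ≡ z
  ∣p∣≤3⇒covered-by-triple {x} {y} {z} {w} {p} ∣p∣≤3 x∈p y∈p z∈p x≢y y≢z x≢z w∈p
    with w ≟ᶠ x | w ≟ᶠ y | w ≟ᶠ z
  ... | yes w≡x | _       | _       = inj₁ w≡x
  ... | no _    | yes w≡y | _       = inj₂ (inj₁ w≡y)
  ... | no _    | no _    | yes w≡z = inj₂ (inj₂ w≡z)
  ... | no w≢x  | no w≢y  | no w≢z  = ⊥-elim (<⇒≱ 3<∣p∣ ∣p∣≤3)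
    where
    3<∣p∣ : 3 < ∣ p ∣
    3<∣p∣ = ≤-<-trans (distinct-triple⇒3≤∣p∣ (x∈p∧x≢y⇒x∈p-y x∈p (≢-sym w≢x))
                                              (x∈p∧x≢y⇒x∈p-y y∈p (≢-sym w≢y))
                                              (x∈p∧x≢y⇒x∈p-y z∈p (≢-sym w≢z)) x≢y y≢z x≢z)
                      (x∈p⇒∣p-x∣<∣p∣ w∈p)

module _ {n : ℕ} (G : Graph n) where

  infixr 5 _++ʷ_
  _++ʷ_ : ∀ {u w v i j} → Walk G u w i → Walk G w v j → Walk G u v (i + j)
  here     ++ʷ q = q
  step e p ++ʷ q = step e (p ++ʷ q)

  reverse : ∀ {u v k} → Walk G u v k → Walk G v u k
  reverse here = here
  reverse (step {u} {w} {k = k} e p) =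
    subst (Walk G _ u) (+-comm k 1) (reverse p ++ʷ step (subst T (adj-sym G u w) e) here)

  onWalk-last : ∀ {u v k} (p : Walk G u v k) → OnWalk G v p
  onWalk-last here       = on-here here
  onWalk-last (step e p) = on-there e p (onWalk-last p)

  onWalk-++ʳ : ∀ {z u w v i j} (p : Walk G u w i) {q : Walk G w v j} → OnWalk G z q → OnWalk G z (p ++ʷ q)
  onWalk-++ʳ here       z∈q = z∈q
  onWalk-++ʳ (step e p) z∈q = on-there e (p ++ʷ _) (onWalk-++ʳ p z∈q)

  walk? : ∀ k u v → Dec (Walk G u v k)
  walk? zero u v with u ≟ᶠ v
  ... | yes refl = yes here
  ... | no u≢v   = no λ { here → u≢v refl }
  walk? (suc k) u v with any? (λ w → T? (adj G u w) ×-dec walk? k w v)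
  ... | yes (w , e , p) = yes (step e p)
  ... | no none         = no λ { (step e p) → none (_ , e , p) }

  Dist-refl : ∀ {u} → Dist G u u 0
  Dist-refl = here , λ _ _ → z≤n

  Dist-sym : ∀ {u v d} → Dist G u v d → Dist G v u d
  Dist-sym (p , minimal) = reverse p , λ m q → minimal m (reverse q)

  Dist-unique : ∀ {u v a b} → Dist G u v a → Dist G u v b → a ≡ b
  Dist-unique (p , minimalᵖ) (q , minimalᵠ) = ≤-antisym (minimalᵖ _ q) (minimalᵠ _ p)

  walk⇒Dist : ∀ {u v k} → Walk G u v k → ∃ (Dist G u v)
  walk⇒Dist {u} {v} {k} p = shorten k (<-wellFounded k) p
    where
    shorten : ∀ k → Acc _<_ k → Walk G u v k → ∃ (Dist G u v)
    shorten k (acc shorter) p with anyUpTo? (λ m → walk? m u v) k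
    ... | yes (m , m<k , q) = shorten m (shorter m<k) q
    ... | no none           = k , p , λ m q → ≮⇒≥ (λ m<k → none (m , m<k , q))

  Dist-exists : Connected G → ∀ u v → ∃ (Dist G u v)
  Dist-exists conn u v = walk⇒Dist (proj₂ (conn u v))

  position : ∀ {z u v k} {p : Walk G u v k} → OnWalk G z p → ℕ
  position (on-here _)      = 0
  position (on-there _ _ o) = suc (position o)

  position≤length : ∀ {z u v k} {p : Walk G u v k} (o : OnWalk G z p) → position o ≤ k
  position≤length (on-here _)      = z≤n
  position≤length (on-there _ _ o) = s≤s (position≤length o)

  prefix : ∀ {z u v k} {p : Walk G u v k} (o : OnWalk G z p) → Walk G u z (position o)
  prefix (on-here _)      = here
  prefix (on-there e _ o) = step e (prefix o)

  suffix : ∀ {z u v k} {p : Walk G u v k} (o : OnWalk G z p) → Walk G z v (k ∸ position o)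
  suffix (on-here p)      = p
  suffix (on-there _ _ o) = suffix o

  segment : ∀ {a b u v k} {p : Walk G u v k} (oa : OnWalk G a p) (ob : OnWalk G b p) →
            position oa ≤ position ob → Walk G a b (position ob ∸ position oa)
  segment (on-here _)       ob                _         = prefix ob
  segment (on-there _ _ oa) (on-there _ _ ob) (s≤s le) = segment oa ob le

  Dist-segment : ∀ {a b u v k} → Dist G u v k → (p : Walk G u v k)
                 (oa : OnWalk G a p) (ob : OnWalk G b p) (le : position oa ≤ position ob) →
                 Dist G a b (position ob ∸ position oa)
  Dist-segment {k = k} (_ , minimal) p oa ob le = segment oa ob le , shortest
    where
    i = position oa
    j = position ob
    shortest : ∀ m → Walk G _ _ m → j ∸ i ≤ m
    shortest m q = m≤n+o⇒m∸n≤o j i (+-cancelʳ-≤ (k ∸ j) j (i + m) (begin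
      j + (k ∸ j)       ≡⟨ m+[n∸m]≡n (position≤length ob) ⟩
      k                 ≤⟨ minimal _ (prefix oa ++ʷ q ++ʷ suffix ob) ⟩
      i + (m + (k ∸ j)) ≡⟨ +-assoc i m (k ∸ j) ⟨
      i + m + (k ∸ j)   ∎))
      where open ≤-Reasoning

  Dist-onWalk : ∀ {a b u v k} → Dist G u v k → (p : Walk G u v k)
                (oa : OnWalk G a p) (ob : OnWalk G b p) →
                Dist G a b ∣ position oa - position ob ∣
  Dist-onWalk {a} {b} d p oa ob with ≤-total (position oa) (position ob)
  ... | inj₁ le = subst (Dist G a b) (sym (m≤n⇒∣m-n∣≡n∸m le)) (Dist-segment d p oa ob le)
  ... | inj₂ ge = subst (Dist G a b) (sym (m≤n⇒∣n-m∣≡n∸m ge)) (Dist-sym (Dist-segment d p ob oa ge))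

  OnCommonGeodesic : Fin n → Fin n → Fin n → Set
  OnCommonGeodesic x y z =
    ∃₂ λ u v → ∃ λ k → Σ (Walk G u v k) λ p →
      Dist G u v k × OnWalk G x p × OnWalk G y p × OnWalk G z p

  onCommonGeodesic-swap₁₂ : ∀ {x y z} → OnCommonGeodesic x y z → OnCommonGeodesic y x z
  onCommonGeodesic-swap₁₂ (u , v , k , p , d , ox , oy , oz) = u , v , k , p , d , oy , ox , oz

  onCommonGeodesic-swap₂₃ : ∀ {x y z} → OnCommonGeodesic x y z → OnCommonGeodesic x z y
  onCommonGeodesic-swap₂₃ (u , v , k , p , d , ox , oy , oz) = u , v , k , p , d , ox , oz , oy

  Dist-+⇒onCommonGeodesic : ∀ {u w v i j} → Dist G u w i → Dist G w v j → Dist G u v (i + j) →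
                            OnCommonGeodesic u w v
  Dist-+⇒onCommonGeodesic (p , _) (q , _) d =
    _ , _ , _ , p ++ʷ q , d , on-here _ , onWalk-++ʳ p (on-here q) , onWalk-++ʳ p (onWalk-last q)

  onCommonGeodesic⇒inLine : ∀ {x y z} → OnCommonGeodesic x y z → InLine G x y z
  onCommonGeodesic⇒inLine (_ , _ , _ , p , d , ox , oy , oz) a b c dxy dxz dzy
    rewrite Dist-unique dxy (Dist-onWalk d p ox oy)
          | Dist-unique dxz (Dist-onWalk d p ox oz)
          | Dist-unique dzy (Dist-onWalk d p oz oy)
    = ∣-∣-collinear (position ox) (position oy) (position oz)

  ¬¬onCommonGeodesic⇒inLine : ∀ {x y z} → ¬ ¬ OnCommonGeodesic x y z → InLine G x y z
  ¬¬onCommonGeodesic⇒inLine ¬¬col a b c dxy dxz dzy =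
    decidable-stable (a ≟ℕ b + c ⊎-dec a ≟ℕ ∣ b - c ∣)
      (λ ¬inLine → ¬¬col (λ col → ¬inLine (onCommonGeodesic⇒inLine col a b c dxy dxz dzy)))

  inLine⇒onCommonGeodesic : Connected G → ∀ {x y z} → InLine G x y z → OnCommonGeodesic x y z
  inLine⇒onCommonGeodesic conn {x} {y} {z} inLine
    with Dist-exists conn x y | Dist-exists conn x z | Dist-exists conn z y
  ... | a , dxy | b , dxz | c , dzy with inLine a b c dxy dxz dzy
  ... | inj₁ a≡b+c = onCommonGeodesic-swap₂₃
        (Dist-+⇒onCommonGeodesic dxz dzy (subst (Dist G x y) a≡b+c dxy))
  ... | inj₂ refl with ∣m-n∣-cases b c
  ...   | inj₁ b≡a+c = Dist-+⇒onCommonGeodesic dxy (Dist-sym dzy) (subst (Dist G x z) b≡a+c dxz)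
  ...   | inj₂ c≡b+a = onCommonGeodesic-swap₂₃ (onCommonGeodesic-swap₁₂
        (Dist-+⇒onCommonGeodesic (Dist-sym dxz) dxy (subst (Dist G z y) c≡b+a dzy)))

  ∣S∣≤2⇒generalPosition : ∀ {S} → ∣ S ∣ ≤ 2 → GeneralPosition G S
  ∣S∣≤2⇒generalPosition ∣S∣≤2 _ _ _ _ x∈S y∈S z∈S x≢y y≢z x≢z _ _ _ =
    <⇒≱ (distinct-triple⇒3≤∣p∣ x∈S y∈S z∈S x≢y y≢z x≢z) ∣S∣≤2

  ∣S∣≤3⇒generalPosition : ∀ {S x y z} → ∣ S ∣ ≤ 3 → x ∈ S → y ∈ S → z ∈ S →
                          ¬ OnCommonGeodesic x y z → GeneralPosition G S
  ∣S∣≤3⇒generalPosition {S} ∣S∣≤3 x∈S y∈S z∈S ¬col (p , d) a b c a∈S b∈S c∈S a≢b b≢c a≢c oa ob oc =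
    ¬col (_ , _ , _ , p , d , onWalk x∈S , onWalk y∈S , onWalk z∈S)
    where
    onWalk : ∀ {w} → w ∈ S → OnWalk G w p
    onWalk w∈S with ∣p∣≤3⇒covered-by-triple ∣S∣≤3 a∈S b∈S c∈S a≢b b≢c a≢c w∈S
    ... | inj₁ refl        = oa
    ... | inj₂ (inj₁ refl) = ob
    ... | inj₂ (inj₂ refl) = oc

  generalPosition⇒¬onCommonGeodesic : ∀ {S x y z} → GeneralPosition G S → x ∈ S → y ∈ S → z ∈ S →
                                      x ≢ y → y ≢ z → x ≢ z → ¬ OnCommonGeodesic x y z
  generalPosition⇒¬onCommonGeodesic gp x∈S y∈S z∈S x≢y y≢z x≢z (_ , _ , _ , p , d , ox , oy , oz) =
    gp (p , d) _ _ _ x∈S y∈S z∈S x≢y y≢z x≢z ox oy oz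

  maximalGP⇒2≤∣S∣ : ∀ {S x y} → x ≢ y → MaximalGP G S → 2 ≤ ∣ S ∣
  maximalGP⇒2≤∣S∣ {S} {x} {y} x≢y (_ , maximal) =
    ≮⇒≥ λ ∣S∣<2 → <⇒≱ ∣S∣<2 (distinct-pair⇒2≤∣p∣ (absorbs ∣S∣<2 x) (absorbs ∣S∣<2 y) x≢y)
    where
    absorbs : ∣ S ∣ < 2 → ∀ v → v ∈ S
    absorbs ∣S∣<2 v = maximal (S ∪ ⁅ v ⁆)
      (∣S∣≤2⇒generalPosition (≤-trans (∣p∪⁅x⁆∣≤1+∣p∣ S v) ∣S∣<2)) (p⊆p∪q ⁅ v ⁆) (x∈p∪⁅x⁆ S v)

  maximalGP-pair⇒universalLine : Connected G → ∀ {S x y} → MaximalGP G S → ∣ S ∣ ≡ 2 →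
                                 x ∈ S → y ∈ S → x ≢ y → UniversalLine G x y
  maximalGP-pair⇒universalLine conn {S} {x} {y} (_ , maximal) ∣S∣≡2 x∈S y∈S x≢y =
    x≢y , λ z → ¬¬onCommonGeodesic⇒inLine (collinear z)
    where
    dxy = proj₂ (Dist-exists conn x y)
    collinear : ∀ z → ¬ ¬ OnCommonGeodesic x y z
    collinear z ¬col with z ≟ᶠ x | z ≟ᶠ y
    ... | yes refl | _        = ¬col (onCommonGeodesic-swap₂₃ (Dist-+⇒onCommonGeodesic Dist-refl dxy dxy))
    ... | no _     | yes refl = ¬col (Dist-+⇒onCommonGeodesic dxy Dist-refl
                                       (subst (Dist G x y) (sym (+-identityʳ _)) dxy))
    ... | no z≢x   | no z≢y   =
      <⇒≱ (distinct-triple⇒3≤∣p∣ x∈S y∈S z∈S x≢y (≢-sym z≢y) (≢-sym z≢x)) (≤-reflexive ∣S∣≡2)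
      where
      ∣S∪⁅z⁆∣≤3 : ∣ S ∪ ⁅ z ⁆ ∣ ≤ 3
      ∣S∪⁅z⁆∣≤3 = ≤-trans (∣p∪⁅x⁆∣≤1+∣p∣ S z) (s≤s (≤-reflexive ∣S∣≡2))
      z∈S : z ∈ S
      z∈S = maximal (S ∪ ⁅ z ⁆)
        (∣S∣≤3⇒generalPosition ∣S∪⁅z⁆∣≤3 (p⊆p∪q ⁅ z ⁆ x∈S) (p⊆p∪q ⁅ z ⁆ y∈S) (x∈p∪⁅x⁆ S z) ¬col)
        (p⊆p∪q ⁅ z ⁆) (x∈p∪⁅x⁆ S z)

  universalLine⇒maximalGP-pair : Connected G → ∀ {x y} → UniversalLine G x y → MaximalGP G (⁅ x ⁆ ∪ ⁅ y ⁆)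
  universalLine⇒maximalGP-pair conn {x} {y} (x≢y , line) =
    ∣S∣≤2⇒generalPosition (≤-reflexive (∣⁅x⁆∪⁅y⁆∣≡2 x≢y)) , maximal
    where
    x∈S : x ∈ ⁅ x ⁆ ∪ ⁅ y ⁆
    x∈S = p⊆p∪q ⁅ y ⁆ (x∈⁅x⁆ x)
    maximal : ∀ T → GeneralPosition G T → ⁅ x ⁆ ∪ ⁅ y ⁆ ⊆ T → T ⊆ ⁅ x ⁆ ∪ ⁅ y ⁆
    maximal T gp S⊆T {w} w∈T with w ≟ᶠ x | w ≟ᶠ y
    ... | yes refl | _        = x∈S
    ... | no _     | yes refl = x∈p∪⁅x⁆ ⁅ x ⁆ y
    ... | no w≢x   | no w≢y   = ⊥-elim (generalPosition⇒¬onCommonGeodesic gp (S⊆T x∈S) (S⊆T (x∈p∪⁅x⁆ ⁅ x ⁆ y)) w∈T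
                                  x≢y (≢-sym w≢y) (≢-sym w≢x) (inLine⇒onCommonGeodesic conn (line w)))

proposition2p1 : (n : ℕ) (G : Graph n) → Connected G →
    (LowerGPNumber G 2 ⇔ HasUniversalLine G)
proposition2p1 n G conn = mk⇔ lowerGP≡2⇒universalLine universalLine⇒lowerGP≡2
  where
  lowerGP≡2⇒universalLine : LowerGPNumber G 2 → HasUniversalLine G
  lowerGP≡2⇒universalLine ((S , maximalS , ∣S∣≡2) , _) with 2≤∣p∣⇒distinct-pair (≤-reflexive (sym ∣S∣≡2))
  ... | x , y , x∈S , y∈S , x≢y = x , y , maximalGP-pair⇒universalLine G conn maximalS ∣S∣≡2 x∈S y∈S x≢y

  universalLine⇒lowerGP≡2 : HasUniversalLine G → LowerGPNumber G 2
  universalLine⇒lowerGP≡2 (x , y , line@(x≢y , _)) =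
    (⁅ x ⁆ ∪ ⁅ y ⁆ , universalLine⇒maximalGP-pair G conn line , ∣⁅x⁆∪⁅y⁆∣≡2 x≢y) ,
    λ S maximalS → maximalGP⇒2≤∣S∣ G x≢y maximalS
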